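{- Let $b < c$ be positive integers. For $n \ge 0$ let $a(n)$ be the number of $n$-color compositions of $n$ in which every part has color $b$ or $c$, and set $a(n)=0$ for $n \le -1$. Then $a(0) = 1$, $a(n) = 0$ for $1 \le n \le b-1$, and \[ a(n) = a(n-1) + a(n-b) + a(n-c) \] for every $n \ge 2$. Moreover, for every $n \ge 1$, \[ a(n) = \sum_{m=1}^{n} \sum_{i=0}^{n-bm} \binom{i+m-1}{m-1} \binom{m}{(n-bm-i)/(c-b)}, \] where $\binom{m}{x} = 0$ whenever $x$ is not an integer, and an inner sum with upper limit $n-bm<0$ is empty.
   Context: An $n$-color composition of a positive integer $n$ is a finite sequence of parts $(\kappa^{(1)}_{c_1}, \ldots, \kappa^{(r)}_{c_r})$, where $\kappa^{(1)}, \ldots, \kappa^{(r)}$ are positive integers with sum $n$ and each part $\kappa^{(j)}$ carries a color $c_j \in \{1, \ldots, \kappa^{(j)}\}$. By convention there is exactly one (empty) composition of $0$. -}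

module Defs where

open import Data.Nat using (ℕ; zero; suc; _+_; _*_; _∸_; _≤?_; _≟_)
open import Data.Nat.DivMod using (_%_; _/_)
open import Data.Nat.Combinatorics using (_C_)
open import Data.Product using (_×_; _,_; proj₂)
open import Data.List using (List; []; _∷_; [_]; map; concatMap; length; filter)
open import Data.List.Relation.Unary.All using (All)
open import Data.Sum using (_⊎_)
open import Relation.Binary.PropositionalEquality using (_≡_)
open import Relation.Nullary using (yes; no; Dec)
open import Data.List.Relation.Unary.All using (all?)
open import Relation.Nullary.Decidable using (_⊎-dec_)

oneTo : ℕ → List ℕ
oneTo zero    = []
oneTo (suc k) = oneTo k Data.List.++ [ suc k ]
  where import Data.List

-- A part of an n-color composition: (size κ , color c) with 1 ≤ c ≤ κ.
Part : Set
Part = ℕ × ℕ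

-- compsF f n : all n-color compositions of n (as lists of parts, in order),
-- using fuel f ≥ n (each part has size ≥ 1, so fuel n suffices).
compsF : ℕ → ℕ → List (List Part)
compsF _       zero    = [ [] ]
compsF zero    (suc n) = []
compsF (suc f) (suc n) =
  concatMap (λ k → concatMap (λ col → map ((k , col) ∷_) (compsF f (suc n ∸ k)))
                             (oneTo k))
            (oneTo (suc n))

nColorCompositions : ℕ → List (List Part)
nColorCompositions n = compsF n n

ColoredBC : ℕ → ℕ → List Part → Set
ColoredBC b c p = All (λ x → proj₂ x ≡ b ⊎ proj₂ x ≡ c) p

coloredBC? : (b c : ℕ) → (p : List Part) → Dec (ColoredBC b c p)
coloredBC? b c = all? (λ x → (proj₂ x ≟ b) ⊎-dec (proj₂ x ≟ c))

a : ℕ → ℕ → ℕ → ℕ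
a b c n = length (filter (coloredBC? b c) (nColorCompositions n))

-- aSub b c n m = a(n - m), with the convention a(k) = 0 for k ≤ -1.
aSub : ℕ → ℕ → ℕ → ℕ → ℕ
aSub b c n m with m ≤? n
... | yes _ = a b c (n ∸ m)
... | no  _ = 0

-- binomFrac m x d = binom(m, x/d) if d ∣ x, and 0 if x/d is not an integer
-- (d is always c - b ≥ 1 in the statement; d = 0 gives 0).
binomFrac : ℕ → ℕ → ℕ → ℕ
binomFrac m x zero = 0
binomFrac m x (suc d) with x % suc d ≟ 0
... | yes _ = m C (x / suc d)
... | no  _ = 0

sumFromZeroTo : ℕ → (ℕ → ℕ) → ℕ
sumFromZeroTo zero    f = f 0
sumFromZeroTo (suc k) f = sumFromZeroTo k f + f (suc k)

sumFromOneTo : ℕ → (ℕ → ℕ) → ℕ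
sumFromOneTo zero    f = 0
sumFromOneTo (suc n) f = sumFromOneTo n f + f (suc n)

innerSum : ℕ → ℕ → ℕ → ℕ → ℕ
innerSum b c n m with b * m ≤? n
... | yes _ = sumFromZeroTo (n ∸ b * m)
                (λ i → (((i + m) ∸ 1) C (m ∸ 1)) * binomFrac m ((n ∸ b * m) ∸ i) (c ∸ b))
... | no  _ = 0

closedForm : ℕ → ℕ → ℕ → ℕ
closedForm b c n = sumFromOneTo n (λ m → innerSum b c n m)

-- Let w k = [k ≥ b] + [k ≥ c] be the number of colours in {b, c} available to a part
-- of size k.  Splitting off the first part gives a(n+1) = Σₖ w k · a(n+1-k), i.e.
-- A = 1 + W A for the generating functions, where W = x^b (1 + x^(c-b)) / (1 - x).
-- Multiplying out (1 - x) A = (1 - x) + x^b (1 + x^(c-b)) A gives the recurrence, and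
-- A = Σₘ Wᵐ with Wᵐ = x^(bm) (1 - x)^(-m) (1 + x^(c-b))ᵐ gives the closed form.
-- Working with coefficients in ℕ, the factor 1 - x is never formed: W A is written as
-- x^b times the partial sums of A + x^(c-b) A, and the recurrence is the difference of
-- two consecutive partial sums.

module Submission where

open import Defs
open import Algebra.Bundles using (CommutativeSemigroup)
open import Data.Bool using (true; false; if_then_else_)
open import Data.List using (List; []; _∷_; [_]; _++_; map; concatMap; length; filter)
open import Data.List.Properties using (length-++; filter-++; concatMap-++; ++-identityʳ)
open import Data.Nat using (ℕ; zero; suc; _+_; _*_; _∸_; _<_; _≤_; z≤n; s≤s; _≟_; _≤?_)
open import Data.Nat.Combinatorics using (_C_; nCn≡1; nCk+nC[k+1]≡[n+1]C[k+1]; k>n⇒nCk≡0)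
open import Data.Nat.DivMod using (_%_; _/_; [m+n]%n≡m%n; m<n⇒m%n≡m; m/n≡1+[m∸n]/n; m≥n⇒m/n>0)
open import Data.Nat.Properties
open import Data.Product using (_×_; _,_; ∃; map₂)
open import Data.Sum using (_⊎_; inj₁; inj₂; [_,_]′)
open import Function using (_∘_)
open import Relation.Binary.Bundles using (Setoid)
open import Relation.Binary.PropositionalEquality
  using (_≡_; _≢_; _≗_; refl; sym; trans; cong; cong₂; _→-setoid_; module ≡-Reasoning)
open import Relation.Nullary using (¬_; yes; no; does; contradiction)
open import Relation.Nullary.Decidable using (_⊎-dec_; dec-true; dec-false)
import Relation.Binary.Reasoning.Setoid as SetoidReasoning
open import Algebra.Properties.CommutativeSemigroup +-commutativeSemigroup
  using () renaming (interchange to +-interchange)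

-- Formal power series over ℕ: shift k is multiplication by xᵏ and ones is 1/(1 - x).

Series : Set
Series = ℕ → ℕ

tail : Series → Series
tail f n = f (suc n)

infixl 6 _⊕_
_⊕_ : Series → Series → Series
(f ⊕ g) n = f n + g n

infixl 7 _⋆_
_⋆_ : Series → Series → Series
(f ⋆ g) zero    = f 0 * g 0
(f ⋆ g) (suc n) = f 0 * g (suc n) + (tail f ⋆ g) n

scale : ℕ → Series → Series
scale k f n = k * f n

𝟘 : Series
𝟘 _ = 0

𝟙 : Series
𝟙 zero    = 1
𝟙 (suc _) = 0

ones : Series
ones _ = 1

shift : ℕ → Series → Series
shift zero    f         = f
shift (suc k) f zero    = 0
shift (suc k) f (suc n) = shift k f n

module ≗-Reasoning = SetoidReasoning (ℕ →-setoid ℕ)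

≗-sym : ∀ {f g : Series} → f ≗ g → g ≗ f
≗-sym p n = sym (p n)

⊕-cong : ∀ {f f′ g g′} → f ≗ f′ → g ≗ g′ → f ⊕ g ≗ f′ ⊕ g′
⊕-cong p q n = cong₂ _+_ (p n) (q n)

⋆-cong : ∀ {f f′ g g′} → f ≗ f′ → g ≗ g′ → f ⋆ g ≗ f′ ⋆ g′
⋆-cong p q zero    = cong₂ _*_ (p 0) (q 0)
⋆-cong p q (suc n) = cong₂ _+_ (cong₂ _*_ (p 0) (q (suc n))) (⋆-cong (λ k → p (suc k)) q n)

⋆-congˡ : ∀ {f f′} g → f ≗ f′ → f ⋆ g ≗ f′ ⋆ g
⋆-congˡ g p = ⋆-cong p (λ _ → refl)

⋆-congʳ : ∀ f {g g′} → g ≗ g′ → f ⋆ g ≗ f ⋆ g′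
⋆-congʳ f q = ⋆-cong (λ _ → refl) q

⋆-congʳ-upTo : ∀ f {g g′} n → (∀ i → i ≤ n → g i ≡ g′ i) → (f ⋆ g) n ≡ (f ⋆ g′) n
⋆-congʳ-upTo f zero    q = cong (f 0 *_) (q 0 z≤n)
⋆-congʳ-upTo f (suc n) q = cong₂ _+_ (cong (f 0 *_) (q (suc n) ≤-refl))
  (⋆-congʳ-upTo (tail f) n (λ i i≤n → q i (m≤n⇒m≤1+n i≤n)))

⋆-sucʳ : ∀ f g n → (f ⋆ g) (suc n) ≡ (f ⋆ tail g) n + f (suc n) * g 0
⋆-sucʳ f g zero    = refl
⋆-sucʳ f g (suc n) = begin
  f 0 * g (2 + n) + (tail f ⋆ g) (suc n)                         ≡⟨ cong (f 0 * g (2 + n) +_) (⋆-sucʳ (tail f) g n) ⟩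
  f 0 * g (2 + n) + ((tail f ⋆ tail g) n + f (2 + n) * g 0)      ≡⟨ +-assoc (f 0 * g (2 + n)) _ _ ⟨
  f 0 * g (2 + n) + (tail f ⋆ tail g) n + f (2 + n) * g 0        ∎
  where open ≡-Reasoning

⋆-comm : ∀ f g → f ⋆ g ≗ g ⋆ f
⋆-comm f g zero    = *-comm (f 0) (g 0)
⋆-comm f g (suc n) = begin
  f 0 * g (suc n) + (tail f ⋆ g) n    ≡⟨ cong₂ _+_ (*-comm (f 0) (g (suc n))) (⋆-comm (tail f) g n) ⟩
  g (suc n) * f 0 + (g ⋆ tail f) n    ≡⟨ +-comm (g (suc n) * f 0) _ ⟩
  (g ⋆ tail f) n + g (suc n) * f 0    ≡⟨ ⋆-sucʳ g f n ⟨
  (g ⋆ f) (suc n)                     ∎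
  where open ≡-Reasoning

⋆-distribʳ-⊕ : ∀ h f g → (f ⊕ g) ⋆ h ≗ f ⋆ h ⊕ g ⋆ h
⋆-distribʳ-⊕ h f g zero    = *-distribʳ-+ (h 0) (f 0) (g 0)
⋆-distribʳ-⊕ h f g (suc n) = begin
  (f 0 + g 0) * h (suc n) + ((tail f ⊕ tail g) ⋆ h) n
    ≡⟨ cong₂ _+_ (*-distribʳ-+ (h (suc n)) (f 0) (g 0)) (⋆-distribʳ-⊕ h (tail f) (tail g) n) ⟩
  (f 0 * h (suc n) + g 0 * h (suc n)) + ((tail f ⋆ h) n + (tail g ⋆ h) n)
    ≡⟨ +-interchange (f 0 * h (suc n)) _ _ _ ⟩
  (f 0 * h (suc n) + (tail f ⋆ h) n) + (g 0 * h (suc n) + (tail g ⋆ h) n)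
    ∎
  where open ≡-Reasoning

⋆-distribˡ-⊕ : ∀ f g h → f ⋆ (g ⊕ h) ≗ f ⋆ g ⊕ f ⋆ h
⋆-distribˡ-⊕ f g h n = begin
  (f ⋆ (g ⊕ h)) n          ≡⟨ ⋆-comm f (g ⊕ h) n ⟩
  ((g ⊕ h) ⋆ f) n          ≡⟨ ⋆-distribʳ-⊕ f g h n ⟩
  (g ⋆ f) n + (h ⋆ f) n    ≡⟨ cong₂ _+_ (⋆-comm g f n) (⋆-comm h f n) ⟩
  (f ⋆ g) n + (f ⋆ h) n    ∎
  where open ≡-Reasoning

scale-⋆ : ∀ k f g → scale k f ⋆ g ≗ scale k (f ⋆ g)
scale-⋆ k f g zero    = *-assoc k (f 0) (g 0)
scale-⋆ k f g (suc n) = begin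
  k * f 0 * g (suc n) + (scale k (tail f) ⋆ g) n
    ≡⟨ cong₂ _+_ (*-assoc k (f 0) (g (suc n))) (scale-⋆ k (tail f) g n) ⟩
  k * (f 0 * g (suc n)) + k * (tail f ⋆ g) n
    ≡⟨ *-distribˡ-+ k _ _ ⟨
  k * (f 0 * g (suc n) + (tail f ⋆ g) n)
    ∎
  where open ≡-Reasoning

⋆-assoc : ∀ f g h → (f ⋆ g) ⋆ h ≗ f ⋆ (g ⋆ h)
⋆-assoc f g h zero    = *-assoc (f 0) (g 0) (h 0)
⋆-assoc f g h (suc n) = begin
  f 0 * g 0 * h (suc n) + ((scale (f 0) (tail g) ⊕ tail f ⋆ g) ⋆ h) n
    ≡⟨ cong (f 0 * g 0 * h (suc n) +_) (⋆-distribʳ-⊕ h (scale (f 0) (tail g)) (tail f ⋆ g) n) ⟩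
  f 0 * g 0 * h (suc n) + ((scale (f 0) (tail g) ⋆ h) n + ((tail f ⋆ g) ⋆ h) n)
    ≡⟨ cong₂ (λ x y → f 0 * g 0 * h (suc n) + (x + y)) (scale-⋆ (f 0) (tail g) h n) (⋆-assoc (tail f) g h n) ⟩
  f 0 * g 0 * h (suc n) + (f 0 * (tail g ⋆ h) n + (tail f ⋆ (g ⋆ h)) n)
    ≡⟨ +-assoc (f 0 * g 0 * h (suc n)) _ _ ⟨
  f 0 * g 0 * h (suc n) + f 0 * (tail g ⋆ h) n + (tail f ⋆ (g ⋆ h)) n
    ≡⟨ cong (λ x → x + f 0 * (tail g ⋆ h) n + (tail f ⋆ (g ⋆ h)) n) (*-assoc (f 0) (g 0) (h (suc n))) ⟩
  f 0 * (g 0 * h (suc n)) + f 0 * (tail g ⋆ h) n + (tail f ⋆ (g ⋆ h)) n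
    ≡⟨ cong (_+ (tail f ⋆ (g ⋆ h)) n) (*-distribˡ-+ (f 0) _ _) ⟨
  f 0 * (g ⋆ h) (suc n) + (tail f ⋆ (g ⋆ h)) n
    ∎
  where open ≡-Reasoning

⋆-zeroʳ : ∀ f → f ⋆ 𝟘 ≗ 𝟘
⋆-zeroʳ f zero    = *-zeroʳ (f 0)
⋆-zeroʳ f (suc n) = cong₂ _+_ (*-zeroʳ (f 0)) (⋆-zeroʳ (tail f) n)

⋆-identityˡ : ∀ f → 𝟙 ⋆ f ≗ f
⋆-identityˡ f zero    = +-identityʳ (f 0)
⋆-identityˡ f (suc n) = begin
  f (suc n) + 0 + (𝟘 ⋆ f) n    ≡⟨ cong₂ _+_ (+-identityʳ (f (suc n))) (trans (⋆-comm 𝟘 f n) (⋆-zeroʳ f n)) ⟩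
  f (suc n) + 0                ≡⟨ +-identityʳ (f (suc n)) ⟩
  f (suc n)                    ∎
  where open ≡-Reasoning

⋆-identityʳ : ∀ f → f ⋆ 𝟙 ≗ f
⋆-identityʳ f n = trans (⋆-comm f 𝟙 n) (⋆-identityˡ f n)

⋆-commutativeSemigroup : CommutativeSemigroup _ _
⋆-commutativeSemigroup = record
  { Carrier = Series
  ; _≈_     = _≗_
  ; _∙_     = _⋆_
  ; isCommutativeSemigroup = record
    { isSemigroup = record
      { isMagma = record
        { isEquivalence = Setoid.isEquivalence (ℕ →-setoid ℕ)
        ; ∙-cong        = ⋆-cong
        }
      ; assoc = ⋆-assoc
      }
    ; comm = ⋆-comm
    }
  }

open import Algebra.Properties.CommutativeSemigroup ⋆-commutativeSemigroup using (interchange; xy∙z≈xz∙y)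

shift-cong : ∀ k {f g} → f ≗ g → shift k f ≗ shift k g
shift-cong zero    p n       = p n
shift-cong (suc k) p zero    = refl
shift-cong (suc k) p (suc n) = shift-cong k p n

shift-+ : ∀ j k f → shift (j + k) f ≗ shift j (shift k f)
shift-+ zero    k f n       = refl
shift-+ (suc j) k f zero    = refl
shift-+ (suc j) k f (suc n) = shift-+ j k f n

shift-⊕ : ∀ k f g → shift k (f ⊕ g) ≗ shift k f ⊕ shift k g
shift-⊕ zero    f g n       = refl
shift-⊕ (suc k) f g zero    = refl
shift-⊕ (suc k) f g (suc n) = shift-⊕ k f g n

shift-⋆ : ∀ k f g → shift k f ⋆ g ≗ shift k (f ⋆ g)
shift-⋆ zero    f g n       = refl
shift-⋆ (suc k) f g zero    = refl
shift-⋆ (suc k) f g (suc n) = shift-⋆ k f g n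

⋆-shift : ∀ k f g → f ⋆ shift k g ≗ shift k (f ⋆ g)
⋆-shift k f g = begin
  f ⋆ shift k g      ≈⟨ ⋆-comm f (shift k g) ⟩
  shift k g ⋆ f      ≈⟨ shift-⋆ k g f ⟩
  shift k (g ⋆ f)    ≈⟨ shift-cong k (⋆-comm g f) ⟩
  shift k (f ⋆ g)    ∎
  where open ≗-Reasoning

shift-< : ∀ k f {n} → n < k → shift k f n ≡ 0
shift-< (suc k) f {zero}  _         = refl
shift-< (suc k) f {suc n} (s≤s n<k) = shift-< k f n<k

shift-≥ : ∀ k f {n} → k ≤ n → shift k f n ≡ f (n ∸ k)
shift-≥ zero    f         _         = refl
shift-≥ (suc k) f {suc n} (s≤s k≤n) = shift-≥ k f k≤n

shift-𝟙-same : ∀ k → shift k 𝟙 k ≡ 1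
shift-𝟙-same zero    = refl
shift-𝟙-same (suc k) = shift-𝟙-same k

shift-𝟙-other : ∀ {k n} → n ≢ k → shift k 𝟙 n ≡ 0
shift-𝟙-other {zero}  {zero}  n≢k = contradiction refl n≢k
shift-𝟙-other {zero}  {suc n} _   = refl
shift-𝟙-other {suc k} {zero}  _   = refl
shift-𝟙-other {suc k} {suc n} n≢k = shift-𝟙-other (n≢k ∘ cong suc)

1+x^ : ℕ → Series
1+x^ k = 𝟙 ⊕ shift k 𝟙

1+x^-⋆ : ∀ k f → 1+x^ k ⋆ f ≗ f ⊕ shift k f
1+x^-⋆ k f = begin
  (𝟙 ⊕ shift k 𝟙) ⋆ f      ≈⟨ ⋆-distribʳ-⊕ f 𝟙 (shift k 𝟙) ⟩
  𝟙 ⋆ f ⊕ shift k 𝟙 ⋆ f    ≈⟨ ⊕-cong (⋆-identityˡ f) (shift-⋆ k 𝟙 f) ⟩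
  f ⊕ shift k (𝟙 ⋆ f)      ≈⟨ ⊕-cong (λ _ → refl) (shift-cong k (⋆-identityˡ f)) ⟩
  f ⊕ shift k f            ∎
  where open ≗-Reasoning

sumFromZeroTo-cong : ∀ n {F G : ℕ → ℕ} → (∀ i → i ≤ n → F i ≡ G i) →
                     sumFromZeroTo n F ≡ sumFromZeroTo n G
sumFromZeroTo-cong zero    p = p 0 z≤n
sumFromZeroTo-cong (suc n) p =
  cong₂ _+_ (sumFromZeroTo-cong n (λ i i≤n → p i (m≤n⇒m≤1+n i≤n))) (p (suc n) ≤-refl)

sumFromOneTo-cong : ∀ n {F G : ℕ → ℕ} → (∀ i → 1 ≤ i → i ≤ n → F i ≡ G i) →
                    sumFromOneTo n F ≡ sumFromOneTo n G
sumFromOneTo-cong zero    p = refl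
sumFromOneTo-cong (suc n) p =
  cong₂ _+_ (sumFromOneTo-cong n (λ i 1≤i i≤n → p i 1≤i (m≤n⇒m≤1+n i≤n))) (p (suc n) (s≤s z≤n) ≤-refl)

sumFromOneTo-suc : ∀ n F → sumFromOneTo (suc n) F ≡ sumFromZeroTo n (λ i → F (suc i))
sumFromOneTo-suc zero    F = refl
sumFromOneTo-suc (suc n) F = cong (_+ F (2 + n)) (sumFromOneTo-suc n F)

sumFromZeroTo-split : ∀ n F → sumFromZeroTo n F ≡ F 0 + sumFromOneTo n F
sumFromZeroTo-split zero    F = sym (+-identityʳ (F 0))
sumFromZeroTo-split (suc n) F =
  trans (cong (_+ F (suc n)) (sumFromZeroTo-split n F)) (+-assoc (F 0) _ _)

sumFromOneTo-distribʳ : ∀ n F x → sumFromOneTo n (λ i → F i * x) ≡ sumFromOneTo n F * x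
sumFromOneTo-distribʳ zero    F x = refl
sumFromOneTo-distribʳ (suc n) F x =
  trans (cong (_+ F (suc n) * x) (sumFromOneTo-distribʳ n F x)) (sym (*-distribʳ-+ x (sumFromOneTo n F) (F (suc n))))

sumFromZeroTo-pad : ∀ {j k} F → (∀ m → j < m → F m ≡ 0) → j ≤ k →
                    sumFromZeroTo j F ≡ sumFromZeroTo k F
sumFromZeroTo-pad F vanish j≤k with m≤n⇒m<n∨m≡n j≤k
... | inj₂ refl = refl
sumFromZeroTo-pad {j} {suc k} F vanish _ | inj₁ (s≤s j≤k) = begin
  sumFromZeroTo j F                  ≡⟨ sumFromZeroTo-pad F vanish j≤k ⟩
  sumFromZeroTo k F                  ≡⟨ +-identityʳ _ ⟨
  sumFromZeroTo k F + 0              ≡⟨ cong (sumFromZeroTo k F +_) (vanish (suc k) (s≤s j≤k)) ⟨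
  sumFromZeroTo k F + F (suc k)      ∎
  where open ≡-Reasoning

⋆-as-sum : ∀ f g n → (f ⋆ g) n ≡ sumFromZeroTo n (λ i → f i * g (n ∸ i))
⋆-as-sum f g zero    = refl
⋆-as-sum f g (suc n) = begin
  (f ⋆ g) (suc n)
    ≡⟨ ⋆-sucʳ f g n ⟩
  (f ⋆ tail g) n + f (suc n) * g 0
    ≡⟨ cong₂ _+_ (⋆-as-sum f (tail g) n) (cong (λ i → f (suc n) * g i) (sym (n∸n≡0 n))) ⟩
  sumFromZeroTo n (λ i → f i * g (suc (n ∸ i))) + f (suc n) * g (n ∸ n)
    ≡⟨ cong (_+ f (suc n) * g (n ∸ n)) (sumFromZeroTo-cong n (λ i i≤n → cong (λ j → f i * g j) (+-∸-assoc 1 i≤n))) ⟨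
  sumFromZeroTo n (λ i → f i * g (suc n ∸ i)) + f (suc n) * g (n ∸ n)
    ∎
  where open ≡-Reasoning

⋆-ones-suc : ∀ f n → (f ⋆ ones) (suc n) ≡ (f ⋆ ones) n + f (suc n)
⋆-ones-suc f n = trans (⋆-sucʳ f ones n) (cong ((f ⋆ ones) n +_) (*-identityʳ (f (suc n))))

sumFromOneTo-⋆-ones : ∀ f → f 0 ≡ 0 → (λ k → sumFromOneTo k f) ≗ f ⋆ ones
sumFromOneTo-⋆-ones f f0≡0 zero    = sym (trans (*-identityʳ (f 0)) f0≡0)
sumFromOneTo-⋆-ones f f0≡0 (suc n) =
  trans (cong (_+ f (suc n)) (sumFromOneTo-⋆-ones f f0≡0 n)) (sym (⋆-ones-suc f n))

⋆-sum : ∀ f (G : ℕ → Series) N →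
        f ⋆ (λ j → sumFromZeroTo N (λ m → G m j)) ≗ (λ n → sumFromZeroTo N (λ m → (f ⋆ G m) n))
⋆-sum f G zero    n = refl
⋆-sum f G (suc N) n = trans (⋆-distribˡ-⊕ f (λ j → sumFromZeroTo N (λ m → G m j)) (G (suc N)) n)
  (cong (_+ (f ⋆ G (suc N)) n) (⋆-sum f G N n))

-- Powers and the geometric series Σₘ wᵐ

power : Series → ℕ → Series
power w zero    = 𝟙
power w (suc m) = w ⋆ power w m

power-cong : ∀ {f g} m → f ≗ g → power f m ≗ power g m
power-cong zero    p n = refl
power-cong (suc m) p   = ⋆-cong p (power-cong m p)

power-⋆ : ∀ f g m → power (f ⋆ g) m ≗ power f m ⋆ power g m
power-⋆ f g zero    = ≗-sym (⋆-identityˡ 𝟙)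
power-⋆ f g (suc m) = begin
  (f ⋆ g) ⋆ power (f ⋆ g) m            ≈⟨ ⋆-congʳ (f ⋆ g) (power-⋆ f g m) ⟩
  (f ⋆ g) ⋆ (power f m ⋆ power g m)    ≈⟨ interchange f g (power f m) (power g m) ⟩
  (f ⋆ power f m) ⋆ (g ⋆ power g m)    ∎
  where open ≗-Reasoning

power-shift : ∀ k f m → power (shift k f) m ≗ shift (k * m) (power f m)
power-shift k f zero    n = cong (λ i → shift i 𝟙 n) (sym (*-zeroʳ k))
power-shift k f (suc m)   = begin
  shift k f ⋆ power (shift k f) m                  ≈⟨ ⋆-congʳ (shift k f) (power-shift k f m) ⟩
  shift k f ⋆ shift (k * m) (power f m)            ≈⟨ shift-⋆ k f _ ⟩
  shift k (f ⋆ shift (k * m) (power f m))          ≈⟨ shift-cong k (⋆-shift (k * m) f (power f m)) ⟩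
  shift k (shift (k * m) (power f (suc m)))        ≈⟨ shift-+ k (k * m) _ ⟨
  shift (k + k * m) (power f (suc m))              ≈⟨ (λ n → cong (λ i → shift i (power f (suc m)) n) (*-suc k m)) ⟨
  shift (k * suc m) (power f (suc m))              ∎
  where open ≗-Reasoning

power-vanish : ∀ {w} → w 0 ≡ 0 → ∀ m {j} → j < m → power w m j ≡ 0
power-vanish {w} w0≡0 (suc m) {zero}  _ = cong (_* power w m 0) w0≡0
power-vanish {w} w0≡0 (suc m) {suc j} (s≤s j<m) = begin
  w 0 * power w m (suc j) + (tail w ⋆ power w m) j
    ≡⟨ cong₂ _+_ (cong (_* power w m (suc j)) w0≡0)
                 (⋆-congʳ-upTo (tail w) j (λ i i≤j → power-vanish w0≡0 m (≤-<-trans i≤j j<m))) ⟩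
  (tail w ⋆ 𝟘) j
    ≡⟨ ⋆-zeroʳ (tail w) j ⟩
  0 ∎
  where open ≡-Reasoning

powerSum : Series → Series
powerSum w n = sumFromZeroTo n (λ m → power w m n)

-- As w 0 ≡ 0, power w m vanishes below degree m, so all the sums may be run up to suc n.
powerSum-suc : ∀ {w} → w 0 ≡ 0 → ∀ n → powerSum w (suc n) ≡ (tail w ⋆ powerSum w) n
powerSum-suc {w} w0≡0 n = sym (begin
  (tail w ⋆ powerSum w) n
    ≡⟨ ⋆-congʳ-upTo (tail w) n (λ i i≤n → sumFromZeroTo-pad (λ m → power w m i)
                                  (λ m i<m → power-vanish w0≡0 m i<m) (m≤n⇒m≤1+n i≤n)) ⟩
  (tail w ⋆ partialSums) n
    ≡⟨ cong (λ x → x * partialSums (suc n) + (tail w ⋆ partialSums) n) (sym w0≡0) ⟩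
  (w ⋆ partialSums) (suc n)
    ≡⟨ ⋆-sum w (power w) (suc n) (suc n) ⟩
  sumFromZeroTo n (λ m → power w (suc m) (suc n)) + power w (2 + n) (suc n)
    ≡⟨ cong (sumFromZeroTo n (λ m → power w (suc m) (suc n)) +_) (power-vanish w0≡0 (2 + n) ≤-refl) ⟩
  sumFromZeroTo n (λ m → power w (suc m) (suc n)) + 0
    ≡⟨ +-identityʳ _ ⟩
  sumFromZeroTo n (λ m → power w (suc m) (suc n))
    ≡⟨ sumFromOneTo-suc n (λ m → power w m (suc n)) ⟨
  sumFromOneTo (suc n) (λ m → power w m (suc n))
    ≡⟨ sumFromZeroTo-split (suc n) (λ m → power w m (suc n)) ⟨
  powerSum w (suc n) ∎)
  where
  open ≡-Reasoning
  partialSums : Series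
  partialSums j = sumFromZeroTo (suc n) (λ m → power w m j)

recurrence-unique : ∀ v {f g} → f 0 ≡ g 0 →
                    (∀ n → f (suc n) ≡ (v ⋆ f) n) → (∀ n → g (suc n) ≡ (v ⋆ g) n) → f ≗ g
recurrence-unique v {f} {g} f0≡g0 f-rec g-rec n = agree n n ≤-refl
  where
  agree : ∀ n i → i ≤ n → f i ≡ g i
  agree _       zero    _         = f0≡g0
  agree (suc n) (suc i) (s≤s i≤n) = begin
    f (suc i)    ≡⟨ f-rec i ⟩
    (v ⋆ f) i    ≡⟨ ⋆-congʳ-upTo v i (λ j j≤i → agree n j (≤-trans j≤i i≤n)) ⟩
    (v ⋆ g) i    ≡⟨ g-rec i ⟨
    g (suc i)    ∎
    where open ≡-Reasoning

-- Binomial series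

negBinom : ℕ → Series
negBinom k i = (i + k) C k

negBinom-⋆-ones : ∀ k → negBinom k ⋆ ones ≗ negBinom (suc k)
negBinom-⋆-ones k zero    = trans (*-identityʳ (k C k)) (trans (nCn≡1 k) (sym (nCn≡1 (suc k))))
negBinom-⋆-ones k (suc n) = begin
  (negBinom k ⋆ ones) (suc n)                 ≡⟨ ⋆-ones-suc (negBinom k) n ⟩
  (negBinom k ⋆ ones) n + negBinom k (suc n)  ≡⟨ cong₂ _+_ (negBinom-⋆-ones k n) (cong (_C k) (sym (+-suc n k))) ⟩
  (n + suc k) C suc k + (n + suc k) C k       ≡⟨ +-comm ((n + suc k) C suc k) _ ⟩
  (n + suc k) C k + (n + suc k) C suc k       ≡⟨ nCk+nC[k+1]≡[n+1]C[k+1] (n + suc k) k ⟩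
  negBinom (suc k) (suc n)                    ∎
  where open ≡-Reasoning

power-ones : ∀ k → power ones (suc k) ≗ negBinom k
power-ones zero    = ⋆-identityʳ ones
power-ones (suc k) = begin
  ones ⋆ power ones (suc k)   ≈⟨ ⋆-congʳ ones (power-ones k) ⟩
  ones ⋆ negBinom k           ≈⟨ ⋆-comm ones (negBinom k) ⟩
  negBinom k ⋆ ones           ≈⟨ negBinom-⋆-ones k ⟩
  negBinom (suc k)            ∎
  where open ≗-Reasoning

sparseBinom : ℕ → ℕ → Series
sparseBinom d m j = binomFrac m j (suc d)

module _ (d : ℕ) where

  private
    D : ℕ
    D = suc d

  sparseBinom-divisible : ∀ m x → x % D ≡ 0 → sparseBinom d m x ≡ m C (x / D)
  sparseBinom-divisible m x D∣x with x % D ≟ 0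
  ... | yes _  = refl
  ... | no D∤x = contradiction D∣x D∤x

  sparseBinom-indivisible : ∀ m x → x % D ≢ 0 → sparseBinom d m x ≡ 0
  sparseBinom-indivisible m x D∤x with x % D ≟ 0
  ... | yes D∣x = contradiction D∣x D∤x
  ... | no _    = refl

  sparseBinom-zero : sparseBinom d 0 ≗ 𝟙
  sparseBinom-zero zero    = refl
  sparseBinom-zero (suc j) with suc j % D ≟ 0
  ... | yes D∣1+j = k>n⇒nCk≡0 (m≥n⇒m/n>0 (≮⇒≥ 1+j≮D))
    where
    1+j≮D : ¬ suc j < D
    1+j≮D 1+j<D = 0≢1+n (trans (sym D∣1+j) (m<n⇒m%n≡m 1+j<D))
  ... | no _ = refl

  sparseBinom-pascal : ∀ m j → sparseBinom d (suc m) (j + D) ≡ sparseBinom d m (j + D) + sparseBinom d m j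
  sparseBinom-pascal m j with j % D ≟ 0
  ... | yes D∣j = begin
    sparseBinom d (suc m) (j + D)          ≡⟨ sparseBinom-divisible (suc m) (j + D) D∣j+D ⟩
    suc m C ((j + D) / D)                  ≡⟨ cong (suc m C_) [j+D]/D≡1+j/D ⟩
    suc m C suc (j / D)                    ≡⟨ nCk+nC[k+1]≡[n+1]C[k+1] m (j / D) ⟨
    m C (j / D) + m C suc (j / D)          ≡⟨ +-comm (m C (j / D)) _ ⟩
    m C suc (j / D) + m C (j / D)          ≡⟨ cong (_+ m C (j / D)) (cong (m C_) [j+D]/D≡1+j/D) ⟨
    m C ((j + D) / D) + m C (j / D)        ≡⟨ cong (_+ m C (j / D)) (sparseBinom-divisible m (j + D) D∣j+D) ⟨
    sparseBinom d m (j + D) + m C (j / D)  ∎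
    where
    open ≡-Reasoning
    D∣j+D : (j + D) % D ≡ 0
    D∣j+D = trans ([m+n]%n≡m%n j D) D∣j
    [j+D]/D≡1+j/D : (j + D) / D ≡ suc (j / D)
    [j+D]/D≡1+j/D = trans (m/n≡1+[m∸n]/n (m≤n+m D j)) (cong (λ x → suc (x / D)) (m+n∸n≡m j D))
  ... | no D∤j = trans (sparseBinom-indivisible (suc m) (j + D) D∤j+D)
                       (sym (cong (_+ 0) (sparseBinom-indivisible m (j + D) D∤j+D)))
    where
    D∤j+D : (j + D) % D ≢ 0
    D∤j+D = D∤j ∘ trans (sym ([m+n]%n≡m%n j D))

  sparseBinom-below : ∀ m {j} → j < D → sparseBinom d (suc m) j ≡ sparseBinom d m j
  sparseBinom-below m {zero}  _     = refl
  sparseBinom-below m {suc j} 1+j<D =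
    trans (sparseBinom-indivisible (suc m) (suc j) D∤1+j) (sym (sparseBinom-indivisible m (suc j) D∤1+j))
    where
    D∤1+j : suc j % D ≢ 0
    D∤1+j D∣1+j = 0≢1+n (trans (sym D∣1+j) (m<n⇒m%n≡m 1+j<D))

  sparseBinom-suc : ∀ m → sparseBinom d (suc m) ≗ sparseBinom d m ⊕ shift D (sparseBinom d m)
  sparseBinom-suc m j with D ≤? j
  ... | no D≰j = begin
    sparseBinom d (suc m) j                             ≡⟨ sparseBinom-below m (≰⇒> D≰j) ⟩
    sparseBinom d m j                                   ≡⟨ +-identityʳ _ ⟨
    sparseBinom d m j + 0                               ≡⟨ cong (sparseBinom d m j +_) (shift-< D (sparseBinom d m) (≰⇒> D≰j)) ⟨
    sparseBinom d m j + shift D (sparseBinom d m) j     ∎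
    where open ≡-Reasoning
  ... | yes D≤j = begin
    sparseBinom d (suc m) j                                   ≡⟨ cong (sparseBinom d (suc m)) (m∸n+n≡m D≤j) ⟨
    sparseBinom d (suc m) (j ∸ D + D)                         ≡⟨ sparseBinom-pascal m (j ∸ D) ⟩
    sparseBinom d m (j ∸ D + D) + sparseBinom d m (j ∸ D)     ≡⟨ cong₂ _+_ (cong (sparseBinom d m) (m∸n+n≡m D≤j))
                                                                           (sym (shift-≥ D (sparseBinom d m) D≤j)) ⟩
    sparseBinom d m j + shift D (sparseBinom d m) j           ∎
    where open ≡-Reasoning

  power-sparse : ∀ m → power (1+x^ D) m ≗ sparseBinom d m
  power-sparse zero    = ≗-sym sparseBinom-zero
  power-sparse (suc m) = begin
    1+x^ D ⋆ power (1+x^ D) m                   ≈⟨ ⋆-congʳ (1+x^ D) (power-sparse m) ⟩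
    1+x^ D ⋆ sparseBinom d m                    ≈⟨ 1+x^-⋆ D (sparseBinom d m) ⟩
    sparseBinom d m ⊕ shift D (sparseBinom d m) ≈⟨ sparseBinom-suc m ⟨
    sparseBinom d (suc m)                       ∎
    where open ≗-Reasoning

-- Counting compositions coloured by b or c

module Counting (b c : ℕ) where

  count : List (List Part) → ℕ
  count L = length (filter (coloredBC? b c) L)

  colourWeight : Series
  colourWeight col = if does ((col ≟ b) ⊎-dec (col ≟ c)) then 1 else 0

  colourWeight-accept : ∀ {col} → col ≡ b ⊎ col ≡ c → colourWeight col ≡ 1
  colourWeight-accept {col} p = cong (if_then 1 else 0) (dec-true ((col ≟ b) ⊎-dec (col ≟ c)) p)

  colourWeight-reject : ∀ {col} → ¬ (col ≡ b ⊎ col ≡ c) → colourWeight col ≡ 0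
  colourWeight-reject {col} ¬p = cong (if_then 1 else 0) (dec-false ((col ≟ b) ⊎-dec (col ≟ c)) ¬p)

  colourWeight-spec : b ≢ c → colourWeight ≗ shift b 𝟙 ⊕ shift c 𝟙
  colourWeight-spec b≢c col with col ≟ b | col ≟ c
  ... | yes refl | _        = trans (colourWeight-accept (inj₁ refl))
                                (sym (cong₂ _+_ (shift-𝟙-same b) (shift-𝟙-other b≢c)))
  ... | no col≢b | yes refl = trans (colourWeight-accept (inj₂ refl))
                                (sym (cong₂ _+_ (shift-𝟙-other col≢b) (shift-𝟙-same c)))
  ... | no col≢b | no col≢c = trans (colourWeight-reject [ col≢b , col≢c ]′)
                                (sym (cong₂ _+_ (shift-𝟙-other col≢b) (shift-𝟙-other col≢c)))

  count-++ : ∀ L M → count (L ++ M) ≡ count L + count M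
  count-++ L M = trans (cong length (filter-++ (coloredBC? b c) L M)) (length-++ (filter (coloredBC? b c) L))

  count-prefix : ∀ k col L → count (map ((k , col) ∷_) L) ≡ colourWeight col * count L
  count-prefix k col []      = sym (*-zeroʳ (colourWeight col))
  count-prefix k col (p ∷ L) with does ((col ≟ b) ⊎-dec (col ≟ c)) | count-prefix k col L
  ... | false | ih = ih
  ... | true  | ih with does (coloredBC? b c p)
  ...   | true  = cong suc ih
  ...   | false = ih

  count-concatMap : ∀ (F : ℕ → List (List Part)) N →
                    count (concatMap F (oneTo N)) ≡ sumFromOneTo N (λ k → count (F k))
  count-concatMap F zero    = refl
  count-concatMap F (suc N) = begin
    count (concatMap F (oneTo N ++ [ suc N ]))                 ≡⟨ cong count (concatMap-++ F (oneTo N) [ suc N ]) ⟩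
    count (concatMap F (oneTo N) ++ (F (suc N) ++ []))         ≡⟨ count-++ (concatMap F (oneTo N)) _ ⟩
    count (concatMap F (oneTo N)) + count (F (suc N) ++ [])    ≡⟨ cong₂ _+_ (count-concatMap F N) (cong count (++-identityʳ (F (suc N)))) ⟩
    sumFromOneTo N (λ k → count (F k)) + count (F (suc N))     ∎
    where open ≡-Reasoning

  partWeight : Series
  partWeight k = sumFromOneTo k colourWeight

  count-compsF-suc : ∀ f n → count (compsF (suc f) (suc n)) ≡
                     sumFromOneTo (suc n) (λ k → partWeight k * count (compsF f (suc n ∸ k)))
  count-compsF-suc f n = trans (count-concatMap _ (suc n)) (sumFromOneTo-cong (suc n) λ k _ _ → begin
    count (concatMap (λ col → map ((k , col) ∷_) (compsF f (suc n ∸ k))) (oneTo k))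
      ≡⟨ count-concatMap (λ col → map ((k , col) ∷_) (compsF f (suc n ∸ k))) k ⟩
    sumFromOneTo k (λ col → count (map ((k , col) ∷_) (compsF f (suc n ∸ k))))
      ≡⟨ sumFromOneTo-cong k (λ col _ _ → count-prefix k col (compsF f (suc n ∸ k))) ⟩
    sumFromOneTo k (λ col → colourWeight col * count (compsF f (suc n ∸ k)))
      ≡⟨ sumFromOneTo-distribʳ k colourWeight (count (compsF f (suc n ∸ k))) ⟩
    partWeight k * count (compsF f (suc n ∸ k))
      ∎)
    where open ≡-Reasoning

  count-compsF-fuel : ∀ f f′ m → m ≤ f → m ≤ f′ → count (compsF f m) ≡ count (compsF f′ m)
  count-compsF-fuel _       _        zero    _         _          = refl
  count-compsF-fuel (suc f) (suc f′) (suc m) (s≤s m≤f) (s≤s m≤f′) = begin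
    count (compsF (suc f) (suc m))                                         ≡⟨ count-compsF-suc f m ⟩
    sumFromOneTo (suc m) (λ k → partWeight k * count (compsF f (suc m ∸ k)))
      ≡⟨ sumFromOneTo-cong (suc m) (λ k 1≤k _ → cong (partWeight k *_)
           (count-compsF-fuel f f′ (suc m ∸ k) (rest≤ 1≤k m≤f) (rest≤ 1≤k m≤f′))) ⟩
    sumFromOneTo (suc m) (λ k → partWeight k * count (compsF f′ (suc m ∸ k)))  ≡⟨ count-compsF-suc f′ m ⟨
    count (compsF (suc f′) (suc m))                                        ∎
    where
    open ≡-Reasoning
    rest≤ : ∀ {k x} → 1 ≤ k → m ≤ x → suc m ∸ k ≤ x
    rest≤ {suc k} _ m≤x = ≤-trans (m∸n≤m m k) m≤x

  a-suc : ∀ n → a b c (suc n) ≡ (tail partWeight ⋆ a b c) n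
  a-suc n = begin
    a b c (suc n)
      ≡⟨ count-compsF-suc n n ⟩
    sumFromOneTo (suc n) (λ k → partWeight k * count (compsF n (suc n ∸ k)))
      ≡⟨ sumFromOneTo-suc n _ ⟩
    sumFromZeroTo n (λ i → partWeight (suc i) * count (compsF n (n ∸ i)))
      ≡⟨ sumFromZeroTo-cong n (λ i _ → cong (partWeight (suc i) *_)
           (count-compsF-fuel n (n ∸ i) (n ∸ i) (m∸n≤m n i) ≤-refl)) ⟩
    sumFromZeroTo n (λ i → partWeight (suc i) * a b c (n ∸ i))
      ≡⟨ ⋆-as-sum (tail partWeight) (a b c) n ⟨
    (tail partWeight ⋆ a b c) n
      ∎
    where open ≡-Reasoning

  aSub-shift : ∀ n m → aSub b c n m ≡ shift m (a b c) n
  aSub-shift n m with m ≤? n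
  ... | yes m≤n = sym (shift-≥ m (a b c) m≤n)
  ... | no  m≰n = sym (shift-< m (a b c) (≰⇒> m≰n))

module TwoColours (b′ d : ℕ) where

  private
    b D c : ℕ
    b = suc b′
    D = suc d
    c = b + D

  open Counting b c

  partWeight-spec : partWeight ≗ shift b (1+x^ D ⋆ ones)
  partWeight-spec = begin
    partWeight                         ≈⟨ sumFromOneTo-⋆-ones colourWeight (colourWeight-spec b≢c 0) ⟩
    colourWeight ⋆ ones                ≈⟨ ⋆-congˡ ones (colourWeight-spec b≢c) ⟩
    (shift b 𝟙 ⊕ shift c 𝟙) ⋆ ones    ≈⟨ ⋆-congˡ ones (⊕-cong (λ _ → refl) (shift-+ b D 𝟙)) ⟩
    (shift b 𝟙 ⊕ shift b (shift D 𝟙)) ⋆ ones ≈⟨ ⋆-congˡ ones (shift-⊕ b 𝟙 (shift D 𝟙)) ⟨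
    shift b (1+x^ D) ⋆ ones            ≈⟨ shift-⋆ b (1+x^ D) ones ⟩
    shift b (1+x^ D ⋆ ones)            ∎
    where
    open ≗-Reasoning
    b≢c : b ≢ c
    b≢c = <⇒≢ (m<m+n b (s≤s z≤n))

  private
    A : Series
    A = a b c

  partWeight-⋆-a : partWeight ⋆ A ≗ shift b ((A ⊕ shift D A) ⋆ ones)
  partWeight-⋆-a = begin
    partWeight ⋆ A                     ≈⟨ ⋆-congˡ A partWeight-spec ⟩
    shift b (1+x^ D ⋆ ones) ⋆ A        ≈⟨ shift-⋆ b (1+x^ D ⋆ ones) A ⟩
    shift b ((1+x^ D ⋆ ones) ⋆ A)      ≈⟨ shift-cong b (xy∙z≈xz∙y (1+x^ D) ones A) ⟩
    shift b ((1+x^ D ⋆ A) ⋆ ones)      ≈⟨ shift-cong b (⋆-congˡ ones (1+x^-⋆ D A)) ⟩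
    shift b ((A ⊕ shift D A) ⋆ ones)   ∎
    where open ≗-Reasoning

  a-suc-spec : ∀ n → A (suc n) ≡ shift b ((A ⊕ shift D A) ⋆ ones) (suc n)
  a-suc-spec n = trans (a-suc n) (partWeight-⋆-a (suc n))

  a-below : (n : ℕ) → 1 ≤ n → n ≤ b ∸ 1 → A n ≡ 0
  a-below (suc n) _ n<b′ = trans (a-suc-spec n) (shift-< b _ (s≤s n<b′))

  a-recurrence : (n : ℕ) → 2 ≤ n → A n ≡ aSub b c n 1 + aSub b c n b + aSub b c n c
  a-recurrence (suc zero)    (s≤s ())
  a-recurrence (suc (suc n)) _ = begin
    A (2 + n)
      ≡⟨ a-suc-spec (suc n) ⟩
    shift b (G ⋆ ones) (2 + n)
      ≡⟨ shift-⋆ b G ones (2 + n) ⟨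
    (shift b G ⋆ ones) (2 + n)
      ≡⟨ ⋆-ones-suc (shift b G) (suc n) ⟩
    (shift b G ⋆ ones) (suc n) + shift b G (2 + n)
      ≡⟨ cong₂ _+_ (trans (shift-⋆ b G ones (suc n)) (sym (a-suc-spec n))) (shift-⊕ b A (shift D A) (2 + n)) ⟩
    A (suc n) + (shift b A (2 + n) + shift b (shift D A) (2 + n))
      ≡⟨ cong (λ x → A (suc n) + (shift b A (2 + n) + x)) (shift-+ b D A (2 + n)) ⟨
    A (suc n) + (shift b A (2 + n) + shift c A (2 + n))
      ≡⟨ +-assoc (A (suc n)) _ _ ⟨
    shift 1 A (2 + n) + shift b A (2 + n) + shift c A (2 + n)
      ≡⟨ cong₂ _+_ (cong₂ _+_ (aSub-shift (2 + n) 1) (aSub-shift (2 + n) b)) (aSub-shift (2 + n) c) ⟨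
    aSub b c (2 + n) 1 + aSub b c (2 + n) b + aSub b c (2 + n) c
      ∎
    where
    open ≡-Reasoning
    G : Series
    G = A ⊕ shift D A

  power-partWeight : ∀ k → power partWeight (suc k) ≗ shift (b * suc k) (negBinom k ⋆ sparseBinom d (suc k))
  power-partWeight k = begin
    power partWeight (suc k)                                    ≈⟨ power-cong (suc k) partWeight-spec ⟩
    power (shift b (1+x^ D ⋆ ones)) (suc k)                     ≈⟨ power-shift b (1+x^ D ⋆ ones) (suc k) ⟩
    shift (b * suc k) (power (1+x^ D ⋆ ones) (suc k))           ≈⟨ shift-cong (b * suc k) (power-⋆ (1+x^ D) ones (suc k)) ⟩
    shift (b * suc k) (power (1+x^ D) (suc k) ⋆ power ones (suc k))
      ≈⟨ shift-cong (b * suc k) (⋆-cong (power-sparse d (suc k)) (power-ones k)) ⟩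
    shift (b * suc k) (sparseBinom d (suc k) ⋆ negBinom k)      ≈⟨ shift-cong (b * suc k) (⋆-comm (sparseBinom d (suc k)) (negBinom k)) ⟩
    shift (b * suc k) (negBinom k ⋆ sparseBinom d (suc k))      ∎
    where open ≗-Reasoning

  innerSum-power : ∀ n {m} → 1 ≤ m → innerSum b c n m ≡ power partWeight m n
  innerSum-power n {suc k} _ with b * suc k ≤? n
  ... | no  bm≰n = sym (trans (power-partWeight k n) (shift-< (b * suc k) _ (≰⇒> bm≰n)))
  ... | yes bm≤n = begin
    sumFromZeroTo (n ∸ b * suc k) (λ i → (((i + suc k) ∸ 1) C k) * binomFrac (suc k) (n ∸ b * suc k ∸ i) (c ∸ b))
      ≡⟨ sumFromZeroTo-cong (n ∸ b * suc k) (λ i _ →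
           cong₂ (λ x y → ((x ∸ 1) C k) * binomFrac (suc k) (n ∸ b * suc k ∸ i) y) (+-suc i k) (m+n∸m≡n b D)) ⟩
    sumFromZeroTo (n ∸ b * suc k) (λ i → negBinom k i * sparseBinom d (suc k) (n ∸ b * suc k ∸ i))
      ≡⟨ ⋆-as-sum (negBinom k) (sparseBinom d (suc k)) (n ∸ b * suc k) ⟨
    (negBinom k ⋆ sparseBinom d (suc k)) (n ∸ b * suc k)
      ≡⟨ shift-≥ (b * suc k) _ bm≤n ⟨
    shift (b * suc k) (negBinom k ⋆ sparseBinom d (suc k)) n
      ≡⟨ power-partWeight k n ⟨
    power partWeight (suc k) n
      ∎
    where open ≡-Reasoning

  a≗powerSum : A ≗ powerSum partWeight
  a≗powerSum = recurrence-unique (tail partWeight) refl a-suc (powerSum-suc refl)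

  a-closedForm : (n : ℕ) → 1 ≤ n → A n ≡ closedForm b c n
  a-closedForm (suc n) _ = begin
    A (suc n)                                           ≡⟨ a≗powerSum (suc n) ⟩
    powerSum partWeight (suc n)                         ≡⟨ sumFromZeroTo-split (suc n) (λ m → power partWeight m (suc n)) ⟩
    sumFromOneTo (suc n) (λ m → power partWeight m (suc n))
      ≡⟨ sumFromOneTo-cong (suc n) (λ m 1≤m _ → innerSum-power (suc n) 1≤m) ⟨
    closedForm b c (suc n)                              ∎
    where open ≡-Reasoning

m<n⇒∃[o]n≡m+1+o : ∀ {m n} → m < n → ∃ λ o → n ≡ m + suc o
m<n⇒∃[o]n≡m+1+o {zero}  {suc n} _         = n , refl
m<n⇒∃[o]n≡m+1+o {suc m} {suc n} (s≤s m<n) = map₂ (cong suc) (m<n⇒∃[o]n≡m+1+o m<n)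

proposition6 : (b c : ℕ) → 0 < b → b < c →
    (a b c 0 ≡ 1)
    × ((n : ℕ) → 1 ≤ n → n ≤ b ∸ 1 → a b c n ≡ 0)
    × ((n : ℕ) → 2 ≤ n → a b c n ≡ aSub b c n 1 + aSub b c n b + aSub b c n c)
    × ((n : ℕ) → 1 ≤ n → a b c n ≡ closedForm b c n)
proposition6 (suc b′) c _ b<c with m<n⇒∃[o]n≡m+1+o b<c
... | d , refl = refl , a-below , a-recurrence , a-closedForm
  where open TwoColours b′ d
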